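{- Let $G$ be a graph with a universal vertex $u$. Then $\Sigma(G)=1+\Psi(G-u)=\Psi(G)$.
   Context: All graphs are finite and simple. A simple fold of a graph with respect to two vertices $x,y$ at distance exactly two is the operation identifying $x$ and $y$ into a single vertex (adjacent to the union of their neighbourhoods). A folding is a homomorphism that is a composition of a sequence of simple folds; $G$ folds onto $H$ if there is such a folding with image $H$. The folding number $\Sigma(G)$ of a connected graph $G$ is the largest $s$ such that $G$ folds onto the complete graph $K_s$; for disconnected $G$ it is the maximum folding number over its components. The achromatic number $\Psi(G)$ is the largest number of colors in a proper vertex coloring of $G$ such that for every two colors there exist two adjacent vertices having those two colors. -}

module Defs where

open import Data.Nat using (ℕ; suc; _≤_)
open import Data.Fin using (Fin; punchIn)
open import Data.Bool using (Bool; true; false)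
open import Data.Product using (Σ; ∃; ∃-syntax; _×_; _,_)
open import Data.Sum using (_⊎_)
open import Relation.Binary.PropositionalEquality using (_≡_; _≢_)
open import Relation.Nullary using (¬_)
open import Function.Bundles using (_⇔_)

record Graph (n : ℕ) : Set where
  field
    edge   : Fin n → Fin n → Bool
    symm   : ∀ a b → edge a b ≡ edge b a
    loopless : ∀ a → edge a a ≡ false

open Graph public

Adj : ∀ {n} → Graph n → Fin n → Fin n → Set
Adj G a b = edge G a b ≡ true

Dist2 : ∀ {n} → Graph n → Fin n → Fin n → Set
Dist2 G x y = x ≢ y × ¬ Adj G x y × ∃[ z ] (Adj G x z × Adj G z y)

-- H (on Fin m) is the result of the simple fold of G identifying x and y,
-- witnessed by the quotient map f : V(G) → V(H) (H determined up to relabelling).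
IsSimpleFold : ∀ {n m} → Graph n → Graph m → Fin n → Fin n → (Fin n → Fin m) → Set
IsSimpleFold G H x y f =
    Dist2 G x y
  × (∀ p → ∃[ a ] f a ≡ p)
  × f x ≡ f y
  × (∀ a b → f a ≡ f b → a ≡ b ⊎ (a ≡ x × b ≡ y) ⊎ (a ≡ y × b ≡ x))
  × (∀ p q → Adj H p q ⇔ (∃[ a ] ∃[ b ] (f a ≡ p × f b ≡ q × Adj G a b)))

SimpleFold : ∀ {n m} → Graph n → Graph m → Set
SimpleFold {n} {m} G H = ∃[ x ] ∃[ y ] Σ (Fin n → Fin m) (IsSimpleFold G H x y)

data FoldsOnto : ∀ {n m} → Graph n → Graph m → Set where
  done : ∀ {n} {G : Graph n} → FoldsOnto G G
  step : ∀ {n k m} {G : Graph n} {G' : Graph k} {H : Graph m} →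
         SimpleFold G G' → FoldsOnto G' H → FoldsOnto G H

IsComplete : ∀ {m} → Graph m → Set
IsComplete H = ∀ p q → p ≢ q → Adj H p q

FoldsOntoK : ∀ {n} → Graph n → ℕ → Set
FoldsOntoK G s = Σ (Graph s) λ H → IsComplete H × FoldsOnto G H

IsMax : (ℕ → Set) → ℕ → Set
IsMax P k = P k × (∀ s → P s → s ≤ k)

IsFoldingNumber : ∀ {n} → Graph n → ℕ → Set
IsFoldingNumber G = IsMax (FoldsOntoK G)

IsCompleteColouring : ∀ {n} → Graph n → (k : ℕ) → (Fin n → Fin k) → Set
IsCompleteColouring {n} G k c =
    (∀ a b → Adj G a b → c a ≢ c b)
  × (∀ i → ∃[ a ] c a ≡ i)
  × (∀ i j → i ≢ j → ∃[ a ] ∃[ b ] (Adj G a b × c a ≡ i × c b ≡ j))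

HasCompleteColouring : ∀ {n} → Graph n → ℕ → Set
HasCompleteColouring {n} G k = Σ (Fin n → Fin k) (IsCompleteColouring G k)

IsAchromaticNumber : ∀ {n} → Graph n → ℕ → Set
IsAchromaticNumber G = IsMax (HasCompleteColouring G)

deleteVertex : ∀ {n} → Graph (suc n) → Fin (suc n) → Graph n
deleteVertex G u = record
  { edge = λ a b → edge G (punchIn u a) (punchIn u b)
  ; symm = λ a b → symm G (punchIn u a) (punchIn u b)
  ; loopless = λ a → loopless G (punchIn u a)
  }

IsUniversal : ∀ {n} → Graph n → Fin n → Set
IsUniversal G u = ∀ v → v ≢ u → Adj G u v

module Submission where

-- Write Ψ for the achromatic number and Σ for the folding number.
--
-- (1) Folding onto K_s yields a complete s-colouring: K_s carries the identity
--     complete colouring, and complete colourings pull back along a simple fold,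
--     which is a homomorphism surjective on vertices and on edges.  So Σ ≤ Ψ.
-- (2) If G has a universal vertex u, two distinct non-adjacent vertices are at
--     distance two (through u), so they can be folded, and the image of u is
--     universal in the folded graph.  Folding two vertices of the same colour of a
--     complete k-colouring keeps it complete; when no such pair is left the
--     colouring is a bijection and the graph is K_k.  So Ψ ≤ Σ.  Folding arbitrary
--     non-adjacent pairs shows moreover that G folds onto some complete graph.
-- (3) For universal u, the colour of u is used by u alone, so complete
--     (s+1)-colourings of G correspond to complete s-colourings of G - u.
-- (4) Having a complete k-colouring is decidable and forces k ≤ |V|, so Ψ(G - u)
--     exists as soon as G - u has some complete colouring, which (2) and (3) give.
-- The theorem then reads Ψ(G - u) = a, Ψ(G) = a + 1 by (3), Σ(G) = Ψ(G) by (1), (2).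

open import Defs
open import Data.Nat using (ℕ; zero; suc; _≤_; s≤s)
import Data.Nat.Properties as ℕ
open import Data.Fin using (Fin; zero; suc; punchIn; punchOut)
open import Data.Fin.Properties
  using (any?; all?; suc-injective; punchIn-injective; punchInᵢ≢i; punchIn-punchOut; injective⇒≤)
  renaming (_≟_ to _≟F_)
open import Data.Vec.Functional using (_∷_; head; tail)
open import Data.Bool using (true)
open import Data.Bool.Properties using () renaming (_≟_ to _≟B_)
open import Data.Product using (Σ; ∃-syntax; _×_; _,_; proj₁; proj₂)
open import Data.Sum using (_⊎_; inj₁; inj₂)
open import Data.Empty using (⊥-elim)
open import Function using (_∘_)
open import Function.Bundles using (_⇔_; mk⇔; Equivalence)
open import Relation.Binary.PropositionalEquality using (_≡_; _≢_; refl; sym; trans; cong)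
open import Relation.Nullary using (Dec; yes; no; does; ¬_)
open import Relation.Nullary.Decidable
  using (_×-dec_; _→-dec_; ¬?; map′; dec-true; dec-false; does-⇔; decidable-stable)

adj⇒≢ : ∀ {n} (G : Graph n) {a b} → Adj G a b → a ≢ b
adj⇒≢ G {a} ab refl with trans (sym ab) (loopless G a)
... | ()

adj-sym : ∀ {n} (G : Graph n) {a b} → Adj G a b → Adj G b a
adj-sym G {a} {b} ab = trans (symm G b a) ab

adj? : ∀ {n} (G : Graph n) a b → Dec (Adj G a b)
adj? G a b = edge G a b ≟B true

does⇔ : ∀ {A : Set} (d : Dec A) → (does d ≡ true) ⇔ A
does⇔ d = mk⇔ (witness d) (dec-true d)
  where
  witness : ∀ {A : Set} (d : Dec A) → does d ≡ true → A
  witness (yes a) _ = a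
  witness (no _) ()

-- A surjection Fin n → Fin k has an injective section, hence k ≤ n.
surjective⇒≤ : ∀ {n k} (c : Fin n → Fin k) → (∀ i → ∃[ a ] c a ≡ i) → k ≤ n
surjective⇒≤ c surj = injective⇒≤ {f = proj₁ ∘ surj} λ {i} {j} e →
  trans (sym (proj₂ (surj i))) (trans (cong c e) (proj₂ (surj j)))

-- Image graphs and simple folds

module _ {n m} (G : Graph n) (f : Fin n → Fin m) where

  ImageAdj : Fin m → Fin m → Set
  ImageAdj p q = ∃[ a ] ∃[ b ] (f a ≡ p × f b ≡ q × Adj G a b)

  imageAdj? : ∀ p q → Dec (ImageAdj p q)
  imageAdj? p q = any? λ a → any? λ b → (f a ≟F p) ×-dec ((f b ≟F q) ×-dec adj? G a b)

  imageAdj-sym : ∀ {p q} → ImageAdj p q → ImageAdj q p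
  imageAdj-sym (a , b , fa≡p , fb≡q , ab) = b , a , fb≡q , fa≡p , adj-sym G ab

  image : (∀ {a b} → Adj G a b → f a ≢ f b) → Graph m
  image noCollapse = record
    { edge     = λ p q → does (imageAdj? p q)
    ; symm     = λ p q → does-⇔ (mk⇔ imageAdj-sym imageAdj-sym) (imageAdj? p q) (imageAdj? q p)
    ; loopless = λ p → dec-false (imageAdj? p p) λ (a , b , fa≡p , fb≡p , ab) →
                   noCollapse ab (trans fa≡p (sym fb≡p))
    }

  image-adj : ∀ (noCollapse : ∀ {a b} → Adj G a b → f a ≢ f b) p q →
              Adj (image noCollapse) p q ⇔ ImageAdj p q
  image-adj _ p q = does⇔ (imageAdj? p q)

-- For x ≢ y, the surjection Fin (suc n) → Fin n that sends x and y to the same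
-- point and is injective elsewhere: punch out around y, sending y where x goes.
module Identify {n} {x y : Fin (suc n)} (x≢y : x ≢ y) where

  identify : Fin (suc n) → Fin n
  identify a with y ≟F a
  ... | yes _ = punchOut (x≢y ∘ sym)
  ... | no y≢a = punchOut y≢a

  section-y : punchIn y (identify y) ≡ x
  section-y with y ≟F y
  ... | yes _ = punchIn-punchOut (x≢y ∘ sym)
  ... | no y≢y = ⊥-elim (y≢y refl)

  section : ∀ a → a ≢ y → punchIn y (identify a) ≡ a
  section a a≢y with y ≟F a
  ... | yes y≡a = ⊥-elim (a≢y (sym y≡a))
  ... | no y≢a = punchIn-punchOut y≢a

  identify-xy : identify x ≡ identify y
  identify-xy = punchIn-injective y _ _ (trans (section x x≢y) (sym section-y))

  identify-surjective : ∀ p → ∃[ a ] identify a ≡ p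
  identify-surjective p =
    punchIn y p , punchIn-injective y _ _ (section (punchIn y p) (punchInᵢ≢i y p))

  identify-kernel : ∀ a b → identify a ≡ identify b → a ≡ b ⊎ (a ≡ x × b ≡ y) ⊎ (a ≡ y × b ≡ x)
  identify-kernel a b e with cong (punchIn y) e | a ≟F y | b ≟F y
  ... | _    | yes refl | yes refl = inj₁ refl
  ... | same | yes refl | no b≢y   = inj₂ (inj₂ (refl , trans (sym (section b b≢y)) (trans (sym same) section-y)))
  ... | same | no a≢y   | yes refl = inj₂ (inj₁ (trans (sym (section a a≢y)) (trans same section-y) , refl))
  ... | same | no a≢y   | no b≢y   = inj₁ (trans (sym (section a a≢y)) (trans same (section b b≢y)))

foldPair : ∀ {n} (G : Graph (suc n)) {x y} (d : Dist2 G x y) →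
           Σ (Graph n) λ H → IsSimpleFold G H x y (Identify.identify (proj₁ d))
foldPair G d@(x≢y , x≁y , _) =
  image G identify noCollapse , d , identify-surjective , identify-xy , identify-kernel ,
  image-adj G identify noCollapse
  where
  open Identify x≢y
  noCollapse : ∀ {a b} → Adj G a b → identify a ≢ identify b
  noCollapse {a} {b} ab e with identify-kernel a b e
  ... | inj₁ refl                 = adj⇒≢ G ab refl
  ... | inj₂ (inj₁ (refl , refl)) = x≁y ab
  ... | inj₂ (inj₂ (refl , refl)) = x≁y (adj-sym G ab)

module SimpleFoldFacts {n m} (G : Graph n) (H : Graph m) {x y : Fin n} {f : Fin n → Fin m}
                       (fold : IsSimpleFold G H x y f) where

  surjective : ∀ p → ∃[ a ] f a ≡ p
  surjective = proj₁ (proj₂ fold)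

  kernel : ∀ a b → f a ≡ f b → a ≡ b ⊎ (a ≡ x × b ≡ y) ⊎ (a ≡ y × b ≡ x)
  kernel = proj₁ (proj₂ (proj₂ (proj₂ fold)))

  edges : ∀ p q → Adj H p q ⇔ ImageAdj G f p q
  edges = proj₂ (proj₂ (proj₂ (proj₂ fold)))

  homomorphism : ∀ {a b} → Adj G a b → Adj H (f a) (f b)
  homomorphism ab = Equivalence.from (edges _ _) (_ , _ , refl , refl , ab)

  universal : ∀ {u} → IsUniversal G u → IsUniversal H (f u)
  universal {u} uni p p≢fu with surjective p
  ... | a , refl = homomorphism (uni a (p≢fu ∘ cong f))

  -- Complete colourings of H pull back to G: vertices and edges of H all have preimages.
  pullColouring : ∀ {k} → HasCompleteColouring H k → HasCompleteColouring G k
  pullColouring (c , proper , onto , meets) = c ∘ f , proper′ , onto′ , meets′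
    where
    proper′ : ∀ a b → Adj G a b → c (f a) ≢ c (f b)
    proper′ a b ab = proper (f a) (f b) (homomorphism ab)
    onto′ : ∀ i → ∃[ a ] c (f a) ≡ i
    onto′ i with onto i
    ... | p , cp≡i with surjective p
    ... | a , refl = a , cp≡i
    meets′ : ∀ i j → i ≢ j → ∃[ a ] ∃[ b ] (Adj G a b × c (f a) ≡ i × c (f b) ≡ j)
    meets′ i j i≢j with meets i j i≢j
    ... | p , q , pq , cp≡i , cq≡j with Equivalence.to (edges p q) pq
    ... | a , b , refl , refl , ab = a , b , ab , cp≡i , cq≡j

  pushColouring : ∀ {k} (c : Fin n → Fin k) → IsCompleteColouring G k c → c x ≡ c y →
                  HasCompleteColouring H k
  pushColouring {k} c (proper , onto , meets) cx≡cy = c′ , proper′ , onto′ , meets′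
    where
    c′ : Fin m → Fin k
    c′ p = c (proj₁ (surjective p))
    descends : ∀ a → c′ (f a) ≡ c a
    descends a with surjective (f a)
    ... | a′ , fa′≡fa with kernel a′ a fa′≡fa
    ... | inj₁ refl                 = refl
    ... | inj₂ (inj₁ (refl , refl)) = cx≡cy
    ... | inj₂ (inj₂ (refl , refl)) = sym cx≡cy
    proper′ : ∀ p q → Adj H p q → c′ p ≢ c′ q
    proper′ p q pq with Equivalence.to (edges p q) pq
    ... | a , b , refl , refl , ab = λ e → proper a b ab (trans (sym (descends a)) (trans e (descends b)))
    onto′ : ∀ i → ∃[ p ] c′ p ≡ i
    onto′ i with onto i
    ... | a , ca≡i = f a , trans (descends a) ca≡i
    meets′ : ∀ i j → i ≢ j → ∃[ p ] ∃[ q ] (Adj H p q × c′ p ≡ i × c′ q ≡ j)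
    meets′ i j i≢j with meets i j i≢j
    ... | a , b , ab , ca≡i , cb≡j =
      f a , f b , homomorphism ab , trans (descends a) ca≡i , trans (descends b) cb≡j

-- Folding onto a complete graph gives a complete colouring (Σ ≤ Ψ)

completeGraphColouring : ∀ {s} (K : Graph s) → IsComplete K → HasCompleteColouring K s
completeGraphColouring K complete =
  (λ a → a) , (λ a b ab → adj⇒≢ K ab) , (λ i → i , refl) , (λ i j i≢j → i , j , complete i j i≢j , refl , refl)

foldsOnto-pullColouring : ∀ {n m s} {G : Graph n} {H : Graph m} →
                          FoldsOnto G H → HasCompleteColouring H s → HasCompleteColouring G s
foldsOnto-pullColouring done col = col
foldsOnto-pullColouring {G = G} (step {G' = G′} (_ , _ , _ , fold) G′↠H) col =
  SimpleFoldFacts.pullColouring G G′ fold (foldsOnto-pullColouring G′↠H col)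

foldsOntoK⇒colouring : ∀ {n s} {G : Graph n} → FoldsOntoK G s → HasCompleteColouring G s
foldsOntoK⇒colouring (K , complete , G↠K) = foldsOnto-pullColouring G↠K (completeGraphColouring K complete)

-- Folding graphs with a universal vertex (Ψ ≤ Σ)

-- With a universal vertex u, two distinct non-adjacent vertices are at distance
-- two through u (neither of them can be u).
nonAdjacent⇒dist2 : ∀ {n} (G : Graph n) {u} → IsUniversal G u →
                    ∀ {x y} → x ≢ y → ¬ Adj G x y → Dist2 G x y
nonAdjacent⇒dist2 G {u} uni {x} {y} x≢y x≁y = x≢y , x≁y , u , adj-sym G (uni x x≢u) , uni y y≢u
  where
  x≢u : x ≢ u
  x≢u refl = x≁y (uni y (x≢y ∘ sym))
  y≢u : y ≢ u
  y≢u refl = x≁y (adj-sym G (uni x x≢y))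

foldNonAdjacent : ∀ {n} (G : Graph (suc n)) {u} → IsUniversal G u → ∀ {x y} → x ≢ y → ¬ Adj G x y →
                  Σ (Graph n) λ H → Σ (Fin (suc n) → Fin n) λ f → IsSimpleFold G H x y f × IsUniversal H (f u)
foldNonAdjacent G uni x≢y x≁y with foldPair G (nonAdjacent⇒dist2 G uni x≢y x≁y)
... | H , fold = H , _ , fold , SimpleFoldFacts.universal G H fold uni

foldsOntoSomeComplete : ∀ {n} (G : Graph n) {u} → IsUniversal G u → ∃[ s ] FoldsOntoK G s
foldsOntoSomeComplete {zero} G {()} _
foldsOntoSomeComplete {suc n} G uni with any? (λ x → any? λ y → ¬? (x ≟F y) ×-dec ¬? (adj? G x y))
... | yes (x , y , x≢y , x≁y) with foldNonAdjacent G uni x≢y x≁y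
... | H , f , fold , uniH with foldsOntoSomeComplete H uniH
... | s , K , complete , H↠K = s , K , complete , step (x , y , f , fold) H↠K
foldsOntoSomeComplete {suc n} G uni | no noPair = suc n , G , complete , done
  where
  complete : IsComplete G
  complete p q p≢q = decidable-stable (adj? G p q) λ p≁q → noPair (p , q , p≢q , p≁q)

-- A complete colouring that is injective is a bijection, and then G is K_k itself.
injectiveColouring⇒foldsOntoK : ∀ {n k} (G : Graph n) (c : Fin n → Fin k) → IsCompleteColouring G k c →
                                (∀ {a b} → c a ≡ c b → a ≡ b) → FoldsOntoK G k
injectiveColouring⇒foldsOntoK G c (_ , onto , meets) injective
  with ℕ.≤-antisym (injective⇒≤ injective) (surjective⇒≤ c onto)
... | refl = G , complete , done
  where
  complete : IsComplete G
  complete p q p≢q with meets (c p) (c q) (p≢q ∘ injective)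
  ... | a , b , ab , ca≡cp , cb≡cq with injective ca≡cp | injective cb≡cq
  ... | refl | refl = ab

-- Folding pairs of equally coloured vertices of a complete k-colouring ends at K_k.
colouring⇒foldsOntoK : ∀ {n k} (G : Graph n) {u} → IsUniversal G u →
                       (c : Fin n → Fin k) → IsCompleteColouring G k c → FoldsOntoK G k
colouring⇒foldsOntoK {zero} G {()} _ _ _
colouring⇒foldsOntoK {suc n} G uni c col with any? (λ x → any? λ y → ¬? (x ≟F y) ×-dec (c x ≟F c y))
... | yes (x , y , x≢y , cx≡cy) with foldNonAdjacent G uni x≢y (λ xy → proj₁ col x y xy cx≡cy)
... | H , f , fold , uniH with SimpleFoldFacts.pushColouring G H fold c col cx≡cy
... | c′ , col′ with colouring⇒foldsOntoK H uniH c′ col′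
... | K , complete , H↠K = K , complete , step (x , y , f , fold) H↠K
colouring⇒foldsOntoK {suc n} G uni c col | no noPair =
  injectiveColouring⇒foldsOntoK G c col λ {a} {b} ca≡cb →
    decidable-stable (a ≟F b) λ a≢b → noPair (a , b , a≢b , ca≡cb)

-- Complete colourings of G versus G - u

vertexView : ∀ {n} (u v : Fin (suc n)) → v ≡ u ⊎ ∃[ a ] punchIn u a ≡ v
vertexView u v with u ≟F v
... | yes refl = inj₁ refl
... | no u≢v = inj₂ (punchOut u≢v , punchIn-punchOut u≢v)

module _ {n} (G : Graph (suc n)) {u : Fin (suc n)} (uni : IsUniversal G u) where

  extendColours : ∀ {k} → (Fin n → Fin k) → Fin (suc n) → Fin (suc k)
  extendColours c v with u ≟F v
  ... | yes _ = zero
  ... | no u≢v = suc (c (punchOut u≢v))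

  extendColours-u : ∀ {k} (c : Fin n → Fin k) → extendColours c u ≡ zero
  extendColours-u c with u ≟F u
  ... | yes _ = refl
  ... | no u≢u = ⊥-elim (u≢u refl)

  extendColours-punchIn : ∀ {k} (c : Fin n → Fin k) a → extendColours c (punchIn u a) ≡ suc (c a)
  extendColours-punchIn c a with u ≟F punchIn u a
  ... | yes u≡a = ⊥-elim (punchInᵢ≢i u a (sym u≡a))
  ... | no u≢a = cong (suc ∘ c) (punchIn-injective u _ _ (punchIn-punchOut u≢a))

  -- A complete k-colouring of G - u plus a fresh colour for u is a complete
  -- (k+1)-colouring of G; the fresh colour meets every other one at u.
  extendColouring : ∀ {k} → HasCompleteColouring (deleteVertex G u) k → HasCompleteColouring G (suc k)
  extendColouring (c , proper , onto , meets) = extendColours c , proper′ , onto′ , meets′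
    where
    proper′ : ∀ a b → Adj G a b → extendColours c a ≢ extendColours c b
    proper′ a b ab with vertexView u a | vertexView u b
    ... | inj₁ refl | inj₁ refl = ⊥-elim (adj⇒≢ G ab refl)
    ... | inj₁ refl | inj₂ (b′ , refl) rewrite extendColours-u c | extendColours-punchIn c b′ = λ ()
    ... | inj₂ (a′ , refl) | inj₁ refl rewrite extendColours-u c | extendColours-punchIn c a′ = λ ()
    ... | inj₂ (a′ , refl) | inj₂ (b′ , refl) rewrite extendColours-punchIn c a′ | extendColours-punchIn c b′ =
      proper a′ b′ ab ∘ suc-injective
    onto′ : ∀ i → ∃[ a ] extendColours c a ≡ i
    onto′ zero = u , extendColours-u c
    onto′ (suc i) with onto i
    ... | a , ca≡i = punchIn u a , trans (extendColours-punchIn c a) (cong suc ca≡i)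
    meets′ : ∀ i j → i ≢ j → ∃[ a ] ∃[ b ] (Adj G a b × extendColours c a ≡ i × extendColours c b ≡ j)
    meets′ zero zero 0≢0 = ⊥-elim (0≢0 refl)
    meets′ zero (suc j) _ with onto j
    ... | b , cb≡j = u , punchIn u b , uni _ (punchInᵢ≢i u b) ,
                     extendColours-u c , trans (extendColours-punchIn c b) (cong suc cb≡j)
    meets′ (suc i) zero _ with onto i
    ... | a , ca≡i = punchIn u a , u , adj-sym G (uni _ (punchInᵢ≢i u a)) ,
                     trans (extendColours-punchIn c a) (cong suc ca≡i) , extendColours-u c
    meets′ (suc i) (suc j) i≢j with meets i j (i≢j ∘ cong suc)
    ... | a , b , ab , ca≡i , cb≡j = punchIn u a , punchIn u b , ab ,
          trans (extendColours-punchIn c a) (cong suc ca≡i) , trans (extendColours-punchIn c b) (cong suc cb≡j)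

  -- In a complete colouring of G the colour of u appears only at u (u is adjacent
  -- to everything else), so punching it out leaves a complete colouring of G - u.
  restrictColouring : ∀ {s} → HasCompleteColouring G s →
                      ∃[ k ] (s ≡ suc k × HasCompleteColouring (deleteVertex G u) k)
  restrictColouring {zero} (c , _) with c u
  ... | ()
  restrictColouring {suc k} (c , proper , onto , meets) = k , refl , c′ , proper′ , onto′ , meets′
    where
    avoids : ∀ a → c u ≢ c (punchIn u a)
    avoids a = proper u (punchIn u a) (uni _ (punchInᵢ≢i u a))
    c′ : Fin n → Fin k
    c′ a = punchOut (avoids a)
    restores : ∀ a → punchIn (c u) (c′ a) ≡ c (punchIn u a)
    restores a = punchIn-punchOut (avoids a)
    c′≡ : ∀ {a i} → c (punchIn u a) ≡ punchIn (c u) i → c′ a ≡ i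
    c′≡ {a} e = punchIn-injective (c u) _ _ (trans (restores a) e)
    proper′ : ∀ a b → Adj (deleteVertex G u) a b → c′ a ≢ c′ b
    proper′ a b ab e = proper _ _ ab (trans (sym (restores a)) (trans (cong (punchIn (c u)) e) (restores b)))
    onto′ : ∀ i → ∃[ a ] c′ a ≡ i
    onto′ i with onto (punchIn (c u) i)
    ... | v , cv≡ with vertexView u v
    ... | inj₁ refl = ⊥-elim (punchInᵢ≢i (c u) i (sym cv≡))
    ... | inj₂ (a , refl) = a , c′≡ cv≡
    meets′ : ∀ i j → i ≢ j → ∃[ a ] ∃[ b ] (Adj (deleteVertex G u) a b × c′ a ≡ i × c′ b ≡ j)
    meets′ i j i≢j with meets (punchIn (c u) i) (punchIn (c u) j) (i≢j ∘ punchIn-injective (c u) _ _)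
    ... | a , b , ab , ca≡ , cb≡ with vertexView u a | vertexView u b
    ... | inj₁ refl | _ = ⊥-elim (punchInᵢ≢i (c u) i (sym ca≡))
    ... | inj₂ _ | inj₁ refl = ⊥-elim (punchInᵢ≢i (c u) j (sym cb≡))
    ... | inj₂ (a′ , refl) | inj₂ (b′ , refl) = a′ , b′ , ab , c′≡ ca≡ , c′≡ cb≡

-- Existence of the achromatic number

-- Whether some f : Fin n → Fin k satisfies a decidable property P is decidable,
-- provided P respects pointwise equality (we have no function extensionality).
anyFunction? : ∀ n {k} (P : (Fin n → Fin k) → Set) → (∀ {f g} → (∀ a → f a ≡ g a) → P f → P g) →
               (∀ f → Dec (P f)) → Dec (Σ (Fin n → Fin k) P)
anyFunction? zero P resp P? =
  map′ (λ p → _ , p) (λ (f , p) → resp (λ ()) p) (P? λ ())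
anyFunction? (suc n) P resp P? =
  map′ (λ (_ , _ , p) → _ , p)
       (λ (f , p) → head f , tail f , resp (λ { zero → refl ; (suc a) → refl }) p)
       (any? λ i → anyFunction? n (P ∘ (i ∷_)) (λ e → resp λ { zero → refl ; (suc a) → e a }) (P? ∘ (i ∷_)))

completeColouring-resp : ∀ {n k} (G : Graph n) {c d : Fin n → Fin k} → (∀ a → c a ≡ d a) →
                         IsCompleteColouring G k c → IsCompleteColouring G k d
completeColouring-resp G c≗d (proper , onto , meets) =
  (λ a b ab e → proper a b ab (trans (c≗d a) (trans e (sym (c≗d b))))) ,
  (λ i → let (a , ca≡i) = onto i in a , trans (sym (c≗d a)) ca≡i) ,
  (λ i j i≢j → let (a , b , ab , ca≡i , cb≡j) = meets i j i≢j in
     a , b , ab , trans (sym (c≗d a)) ca≡i , trans (sym (c≗d b)) cb≡j)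

isCompleteColouring? : ∀ {n k} (G : Graph n) (c : Fin n → Fin k) → Dec (IsCompleteColouring G k c)
isCompleteColouring? G c =
  (all? λ a → all? λ b → adj? G a b →-dec ¬? (c a ≟F c b)) ×-dec
  ((all? λ i → any? λ a → c a ≟F i) ×-dec
   (all? λ i → all? λ j → ¬? (i ≟F j) →-dec
      (any? λ a → any? λ b → adj? G a b ×-dec ((c a ≟F i) ×-dec (c b ≟F j)))))

hasCompleteColouring? : ∀ {n} (G : Graph n) k → Dec (HasCompleteColouring G k)
hasCompleteColouring? {n} G k = anyFunction? n (IsCompleteColouring G k) (completeColouring-resp G) (isCompleteColouring? G)

maximum : (P : ℕ → Set) → (∀ s → Dec (P s)) → ∀ N → (∀ s → P s → s ≤ N) → ∀ {k} → P k → ∃[ m ] IsMax P m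
maximum P P? N bounded {k} pk with P? N
... | yes pN = N , pN , bounded
maximum P P? zero bounded {k} pk | no ¬p0 with ℕ.n≤0⇒n≡0 (bounded k pk)
... | refl = ⊥-elim (¬p0 pk)
maximum P P? (suc N) bounded pk | no ¬pN = maximum P P? N bounded′ pk
  where
  bounded′ : ∀ s → P s → s ≤ N
  bounded′ s ps = ℕ.≤-pred (ℕ.≤∧≢⇒< (bounded s ps) λ { refl → ¬pN ps })

achromaticExists : ∀ {n} (G : Graph n) → ∃[ k ] HasCompleteColouring G k → ∃[ a ] IsAchromaticNumber G a
achromaticExists {n} G (k , col) =
  maximum (HasCompleteColouring G) (hasCompleteColouring? G) n (λ s (c , _ , onto , _) → surjective⇒≤ c onto) col

achromatic-deleteUniversal : ∀ {n} (G : Graph (suc n)) {u} → IsUniversal G u →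
                             ∀ {a} → IsAchromaticNumber (deleteVertex G u) a → IsAchromaticNumber G (suc a)
achromatic-deleteUniversal G uni {a} (col , maximal) = extendColouring G uni col , bounded
  where
  bounded : ∀ s → HasCompleteColouring G s → s ≤ suc a
  bounded s colG with restrictColouring G uni colG
  ... | k , refl , col′ = s≤s (maximal k col′)

folding≡achromatic : ∀ {n} (G : Graph n) {u} → IsUniversal G u →
                     ∀ {k} → IsAchromaticNumber G k → IsFoldingNumber G k
folding≡achromatic G uni ((c , col) , maximal) =
  colouring⇒foldsOntoK G uni c col , λ s G↠K → maximal s (foldsOntoK⇒colouring G↠K)

-- G - u has a complete colouring: restrict the one G gets from folding onto a complete graph.
deletion-hasColouring : ∀ {n} (G : Graph (suc n)) {u} → IsUniversal G u →
                        ∃[ k ] HasCompleteColouring (deleteVertex G u) k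
deletion-hasColouring G uni with restrictColouring G uni (foldsOntoK⇒colouring (proj₂ (foldsOntoSomeComplete G uni)))
... | k , _ , col = k , col

mainTheorem10 : ∀ {n} (G : Graph (suc n)) (u : Fin (suc n)) → IsUniversal G u →
    ∃[ a ] (IsAchromaticNumber (deleteVertex G u) a × IsFoldingNumber G (suc a) × IsAchromaticNumber G (suc a))
mainTheorem10 G u uni with achromaticExists (deleteVertex G u) (deletion-hasColouring G uni)
... | a , ψ[G-u] = a , ψ[G-u] , folding≡achromatic G uni ψ[G] , ψ[G]
  where
  ψ[G] : IsAchromaticNumber G (suc a)
  ψ[G] = achromatic-deleteUniversal G uni ψ[G-u]
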